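{- Let $F$ be a natural graph, let $\{a,b\}\in E(F)$, and let $c,d$ be two distinct positive integers not in $V(F)$. Let $G$ be the natural graph with $V(G)=V(F)\cup\{c,d\}$ and $E(G)=(E(F)\setminus\{\{a,b\}\})\cup\{\{c,d\}\}$. Then $\kappa(F)\le\kappa(G)$.
   Context: A natural graph is a simple graph whose vertex set is a finite subset of $\mathbb{N}=\{1,2,\dots\}$. An infinite permutation of $\mathbb{N}$ is a sequence $(\pi(1),\pi(2),\dots)$ in which every positive integer occurs exactly once. For a natural graph $G$, two infinite permutations $\pi,\sigma$ are $G$-different if $\{\pi(i),\sigma(i)\}\in E(G)$ for some $i$. $\kappa(G)$ is the maximum cardinality of a set of pairwise $G$-different infinite permutations (this is finite for every natural graph). -}

module Defs where

open import Data.Nat using (ℕ)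
open import Data.Fin using (Fin)
open import Data.List using (List)
open import Data.List.Membership.Propositional using (_∈_)
open import Data.Product using (Σ; ∃; _×_)
open import Data.Sum using (_⊎_)
open import Relation.Nullary using (¬_)
open import Relation.Binary.PropositionalEquality using (_≡_)
open import Function.Bundles using (_⤖_; Bijection)

-- Convention: the positive integers {1,2,...} are encoded by ℕ = {0,1,...}
-- via k ↦ k - 1 (a fixed order-preserving bijection); this is a pure renaming.

record NatGraph : Set₁ where
  field
    V       : List ℕ
    Adj     : ℕ → ℕ → Set
    adj-V   : ∀ {x y} → Adj x y → (x ∈ V) × (y ∈ V)
    irrefl  : ∀ {x} → ¬ Adj x x
    sym     : ∀ {x y} → Adj x y → Adj y x
open NatGraph public

SamePair : ℕ → ℕ → ℕ → ℕ → Set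
SamePair x y a b = ((x ≡ a) × (y ≡ b)) ⊎ ((x ≡ b) × (y ≡ a))

InfPerm : Set
InfPerm = ℕ ⤖ ℕ

Different : NatGraph → InfPerm → InfPerm → Set
Different G π σ = ∃ λ i → Adj G (Bijection.to π i) (Bijection.to σ i)

-- G admits a set of n pairwise G-different infinite permutations
-- (indexed by Fin n; distinct indices give G-different, hence distinct, permutations).
Admits : NatGraph → ℕ → Set
Admits G n = Σ (Fin n → InfPerm) λ P → ∀ i j → ¬ (i ≡ j) → Different G (P i) (P j)

-- κ(F) ≤ κ(G), with κ the maximum size of such a set: every size attained for F
-- is attained for G.
κ≤ : NatGraph → NatGraph → Set
κ≤ F G = ∀ n → Admits F n → Admits G n

-- Realise the extra copy of the vertex set by doubling the alphabet: an infinite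
-- permutation π acts on ℕ ⊎ ℕ as π ⊎ π, and a bijection β : (ℕ ⊎ ℕ) ↔ ℕ that fixes
-- V(F) on the left copy and sends a, b on the right copy to c, d carries it back to
-- an infinite permutation of ℕ. Where π and σ differ on an edge {π i, σ i} of F
-- other than {a,b}, the lifts differ on the same edge at β (inj₁ i); where that
-- edge is {a,b}, the lifts differ on {c,d} at β (inj₂ i).
module Submission where

open import Defs
open import Data.Nat using (ℕ)
open import Data.List.Membership.Propositional using (_∈_)
open import Data.Product using (_×_)
open import Data.Sum using (_⊎_)
open import Relation.Nullary using (¬_)
open import Relation.Binary.PropositionalEquality using (_≡_)
open import Function.Bundles using (_⇔_)

open import Data.Nat using (zero; suc; _≤_; _<_; s≤s; z≤n; _≟_)
open import Data.Nat.Properties using (≤-totalOrder; <⇒≢; <-≤-trans)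
open import Data.List using (List; _∷_)
open import Data.List.Extrema ≤-totalOrder using (max; xs≤max)
open import Data.List.Relation.Unary.All as All using (All; _∷_)
open import Data.Product using (∃; _,_; proj₁; proj₂)
open import Data.Sum using (inj₁; inj₂)
open import Data.Sum.Properties using (inj₂-injective)
import Data.Sum as Sum
open import Data.Sum.Function.Propositional using (_⊎-↔_)
open import Data.Empty using (⊥-elim)
open import Function using (_∘_)
open import Function.Bundles using (_↔_; Inverse; Equivalence; Bijection; mk↔ₛ′)
open import Function.Construct.Composition using (_↔-∘_)
open import Function.Construct.Symmetry using (↔-sym)
open import Function.Properties.Inverse using (↔⇒⤖)
open import Function.Properties.Bijection using (⤖⇒↔)
open import Relation.Nullary using (Dec; yes; no)
open import Relation.Nullary.Decidable using (_×-dec_; _⊎-dec_)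
open import Relation.Binary.Definitions using (DecidableEquality)
open import Relation.Binary.PropositionalEquality as ≡
  using (refl; trans; cong; subst₂; module ≡-Reasoning)

open Inverse using (to; from; strictlyInverseˡ; strictlyInverseʳ)

module _ {A : Set} (_≟ᴬ_ : DecidableEquality A) where

  transpose : A → A → A → A
  transpose u v x with x ≟ᴬ u | x ≟ᴬ v
  ... | yes _ | _     = v
  ... | no _  | yes _ = u
  ... | no _  | no _  = x

  transpose-ˡ : ∀ u v → transpose u v u ≡ v
  transpose-ˡ u v with u ≟ᴬ u
  ... | yes _  = refl
  ... | no u≢u = ⊥-elim (u≢u refl)

  transpose-ʳ : ∀ u v → transpose u v v ≡ u
  transpose-ʳ u v with v ≟ᴬ u | v ≟ᴬ v
  ... | yes v≡u | _      = v≡u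
  ... | no _    | yes _  = refl
  ... | no _    | no v≢v = ⊥-elim (v≢v refl)

  transpose-other : ∀ {u v x} → ¬ x ≡ u → ¬ x ≡ v → transpose u v x ≡ x
  transpose-other {u} {v} {x} x≢u x≢v with x ≟ᴬ u | x ≟ᴬ v
  ... | yes x≡u | _       = ⊥-elim (x≢u x≡u)
  ... | no _    | yes x≡v = ⊥-elim (x≢v x≡v)
  ... | no _    | no _    = refl

  transpose-involutive : ∀ u v x → transpose u v (transpose u v x) ≡ x
  transpose-involutive u v x with x ≟ᴬ u | x ≟ᴬ v
  ... | yes refl | _        = transpose-ʳ u v
  ... | no _     | yes refl = transpose-ˡ u v
  ... | no x≢u   | no x≢v   = transpose-other x≢u x≢v

  transposition : A → A → A ↔ A
  transposition u v = mk↔ₛ′ (transpose u v) (transpose u v)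
    (transpose-involutive u v) (transpose-involutive u v)

interleave : (ℕ ⊎ ℕ) ↔ ℕ
interleave = mk↔ₛ′ merge split merge-split split-merge
  where
  merge : ℕ ⊎ ℕ → ℕ
  merge (inj₁ zero)    = 0
  merge (inj₂ zero)    = 1
  merge (inj₁ (suc x)) = suc (suc (merge (inj₁ x)))
  merge (inj₂ (suc y)) = suc (suc (merge (inj₂ y)))

  split : ℕ → ℕ ⊎ ℕ
  split zero          = inj₁ 0
  split (suc zero)    = inj₂ 0
  split (suc (suc n)) = Sum.map suc suc (split n)

  merge-suc : ∀ s → merge (Sum.map suc suc s) ≡ suc (suc (merge s))
  merge-suc (inj₁ _) = refl
  merge-suc (inj₂ _) = refl

  merge-split : ∀ n → merge (split n) ≡ n
  merge-split zero          = refl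
  merge-split (suc zero)    = refl
  merge-split (suc (suc n)) = trans (merge-suc (split n)) (cong (suc ∘ suc) (merge-split n))

  split-merge : ∀ s → split (merge s) ≡ s
  split-merge (inj₁ zero)    = refl
  split-merge (inj₂ zero)    = refl
  split-merge (inj₁ (suc x)) = cong (Sum.map suc suc) (split-merge (inj₁ x))
  split-merge (inj₂ (suc y)) = cong (Sum.map suc suc) (split-merge (inj₂ y))

consˡ : (ℕ ⊎ ℕ) ↔ ℕ → (ℕ ⊎ ℕ) ↔ ℕ
consˡ e = mk↔ₛ′ to′ from′ to′-from′ from′-to′
  where
  to′ : ℕ ⊎ ℕ → ℕ
  to′ (inj₁ zero)    = 0
  to′ (inj₁ (suc x)) = suc (to e (inj₁ x))
  to′ (inj₂ y)       = suc (to e (inj₂ y))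

  from′ : ℕ → ℕ ⊎ ℕ
  from′ zero    = inj₁ 0
  from′ (suc n) = Sum.map₁ suc (from e n)

  to′-suc : ∀ s → to′ (Sum.map₁ suc s) ≡ suc (to e s)
  to′-suc (inj₁ _) = refl
  to′-suc (inj₂ _) = refl

  to′-from′ : ∀ n → to′ (from′ n) ≡ n
  to′-from′ zero    = refl
  to′-from′ (suc n) = trans (to′-suc (from e n)) (cong suc (strictlyInverseˡ e n))

  from′-to′ : ∀ s → from′ (to′ s) ≡ s
  from′-to′ (inj₁ zero)    = refl
  from′-to′ (inj₁ (suc x)) = cong (Sum.map₁ suc) (strictlyInverseʳ e (inj₁ x))
  from′-to′ (inj₂ y)       = cong (Sum.map₁ suc) (strictlyInverseʳ e (inj₂ y))

fixingBelow : ℕ → (ℕ ⊎ ℕ) ↔ ℕ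
fixingBelow zero    = interleave
fixingBelow (suc m) = consˡ (fixingBelow m)

fixingBelow-inj₁ : ∀ {m x} → x < m → to (fixingBelow m) (inj₁ x) ≡ x
fixingBelow-inj₁ {suc m} {zero}  _         = refl
fixingBelow-inj₁ {suc m} {suc x} (s≤s x<m) = cong suc (fixingBelow-inj₁ x<m)

fixingBelow-inj₂ : ∀ m y → m ≤ to (fixingBelow m) (inj₂ y)
fixingBelow-inj₂ zero    y = z≤n
fixingBelow-inj₂ (suc m) y = s≤s (fixingBelow-inj₂ m y)

strictUpperBound : (xs : List ℕ) → ∃ λ m → All (_< m) xs
strictUpperBound xs = suc (max 0 xs) , All.map s≤s (xs≤max 0 xs)

record Relabelling (V : List ℕ) (a b c d : ℕ) : Set where
  field
    bijection : (ℕ ⊎ ℕ) ↔ ℕ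
    fixes     : ∀ {x} → x ∈ V → to bijection (inj₁ x) ≡ x
    sends-a   : to bijection (inj₂ a) ≡ c
    sends-b   : to bijection (inj₂ b) ≡ d

-- Start from fixingBelow m, with m above V, c and d; the images p, q of inj₂ a,
-- inj₂ b lie above m, so the transpositions (c p) and (d q) move nothing in V.
relabellingBelow : ∀ {V a b c d} m → All (_< m) (c ∷ d ∷ V)
  → ¬ a ≡ b → ¬ c ≡ d → ¬ c ∈ V → ¬ d ∈ V → Relabelling V a b c d
relabellingBelow {V} {a} {b} {c} {d} m (c<m ∷ d<m ∷ V<m) a≢b c≢d c∉V d∉V = record
  { bijection = transposition _≟_ c p ↔-∘ (transposition _≟_ d q ↔-∘ e)
  ; fixes     = fixes
  ; sends-a   = sends-a
  ; sends-b   = sends-b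
  }
  where
  e : (ℕ ⊎ ℕ) ↔ ℕ
  e = fixingBelow m

  p q : ℕ
  p = to e (inj₂ a)
  q = to e (inj₂ b)

  below≢p : ∀ {x} → x < m → ¬ x ≡ p
  below≢p x<m = <⇒≢ (<-≤-trans x<m (fixingBelow-inj₂ m a))

  below≢q : ∀ {x} → x < m → ¬ x ≡ q
  below≢q x<m = <⇒≢ (<-≤-trans x<m (fixingBelow-inj₂ m b))

  swap-cp swap-dq : ℕ → ℕ
  swap-cp = transpose _≟_ c p
  swap-dq = transpose _≟_ d q

  open ≡-Reasoning

  p≢q : ¬ p ≡ q
  p≢q p≡q = a≢b (inj₂-injective (begin
    inj₂ a    ≡⟨ strictlyInverseʳ e (inj₂ a) ⟨
    from e p  ≡⟨ cong (from e) p≡q ⟩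
    from e q  ≡⟨ strictlyInverseʳ e (inj₂ b) ⟩
    inj₂ b    ∎))

  fixes : ∀ {x} → x ∈ V → swap-cp (swap-dq (to e (inj₁ x))) ≡ x
  fixes {x} x∈V = begin
    swap-cp (swap-dq (to e (inj₁ x)))
      ≡⟨ cong (swap-cp ∘ swap-dq) (fixingBelow-inj₁ x<m) ⟩
    swap-cp (swap-dq x)
      ≡⟨ cong swap-cp (transpose-other _≟_ (λ { refl → d∉V x∈V }) (below≢q x<m)) ⟩
    swap-cp x
      ≡⟨ transpose-other _≟_ (λ { refl → c∉V x∈V }) (below≢p x<m) ⟩
    x ∎
    where
    x<m : x < m
    x<m = All.lookup V<m x∈V

  sends-a : swap-cp (swap-dq p) ≡ c
  sends-a = begin
    swap-cp (swap-dq p)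
      ≡⟨ cong swap-cp (transpose-other _≟_ (below≢p d<m ∘ ≡.sym) p≢q) ⟩
    swap-cp p
      ≡⟨ transpose-ʳ _≟_ c p ⟩
    c ∎

  sends-b : swap-cp (swap-dq q) ≡ d
  sends-b = begin
    swap-cp (swap-dq q)
      ≡⟨ cong swap-cp (transpose-ʳ _≟_ d q) ⟩
    swap-cp d
      ≡⟨ transpose-other _≟_ (c≢d ∘ ≡.sym) (below≢p d<m) ⟩
    d ∎

relabelling : (V : List ℕ) {a b c d : ℕ} → ¬ a ≡ b → ¬ c ≡ d → ¬ c ∈ V → ¬ d ∈ V
  → Relabelling V a b c d
relabelling V {c = c} {d} = relabellingBelow (proj₁ bound) (proj₂ bound)
  where
  bound : ∃ λ m → All (_< m) (c ∷ d ∷ V)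
  bound = strictUpperBound (c ∷ d ∷ V)

conjugate : ∀ {A B : Set} → A ↔ B → A ↔ A → B ↔ B
conjugate β h = β ↔-∘ (h ↔-∘ ↔-sym β)

conjugate-to : ∀ {A B : Set} (β : A ↔ B) (h : A ↔ A) x
  → to (conjugate β h) (to β x) ≡ to β (to h x)
conjugate-to β h x = cong (to β ∘ to h) (strictlyInverseʳ β x)

lift : (ℕ ⊎ ℕ) ↔ ℕ → InfPerm → InfPerm
lift β π = ↔⇒⤖ (conjugate β (π′ ⊎-↔ π′))
  where
  π′ : ℕ ↔ ℕ
  π′ = ⤖⇒↔ π

lift-to : ∀ β π s
  → Bijection.to (lift β π) (to β s) ≡ to β (Sum.map (Bijection.to π) (Bijection.to π) s)
lift-to β π = conjugate-to β (⤖⇒↔ π ⊎-↔ ⤖⇒↔ π)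

samePair? : ∀ x y a b → Dec (SamePair x y a b)
samePair? x y a b = (x ≟ a ×-dec y ≟ b) ⊎-dec (x ≟ b ×-dec y ≟ a)

module _ (F G : NatGraph) {a b c d : ℕ}
  (adjG : ∀ x y → Adj G x y ⇔ ((Adj F x y × ¬ SamePair x y a b) ⊎ SamePair x y c d))
  (ρ : Relabelling (V F) a b c d) where

  open Relabelling ρ

  different-at : ∀ π σ s
    → Adj G (to bijection (Sum.map (Bijection.to π) (Bijection.to π) s))
            (to bijection (Sum.map (Bijection.to σ) (Bijection.to σ) s))
    → Different G (lift bijection π) (lift bijection σ)
  different-at π σ s adj =
    to bijection s ,
    subst₂ (Adj G) (≡.sym (lift-to bijection π s)) (≡.sym (lift-to bijection σ s)) adj

  adjacent-inj₁ : ∀ {x y} → Adj F x y → ¬ SamePair x y a b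
    → Adj G (to bijection (inj₁ x)) (to bijection (inj₁ y))
  adjacent-inj₁ adjF ¬ab = subst₂ (Adj G)
    (≡.sym (fixes (proj₁ (adj-V F adjF)))) (≡.sym (fixes (proj₂ (adj-V F adjF))))
    (Equivalence.from (adjG _ _) (inj₁ (adjF , ¬ab)))

  adjacent-inj₂ : ∀ {x y} → SamePair x y a b
    → Adj G (to bijection (inj₂ x)) (to bijection (inj₂ y))
  adjacent-inj₂ (inj₁ (refl , refl)) = subst₂ (Adj G) (≡.sym sends-a) (≡.sym sends-b)
    (Equivalence.from (adjG c d) (inj₂ (inj₁ (refl , refl))))
  adjacent-inj₂ (inj₂ (refl , refl)) = subst₂ (Adj G) (≡.sym sends-b) (≡.sym sends-a)
    (Equivalence.from (adjG d c) (inj₂ (inj₂ (refl , refl))))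

  lift-different : ∀ {π σ} → Different F π σ → Different G (lift bijection π) (lift bijection σ)
  lift-different {π} {σ} (i , adjF) with samePair? (Bijection.to π i) (Bijection.to σ i) a b
  ... | yes ab = different-at π σ (inj₂ i) (adjacent-inj₂ ab)
  ... | no ¬ab = different-at π σ (inj₁ i) (adjacent-inj₁ adjF ¬ab)

  lift-κ≤ : κ≤ F G
  lift-κ≤ n (P , different) =
    lift bijection ∘ P , λ i j i≢j → lift-different {P i} {P j} (different i j i≢j)

proposition1 : (F G : NatGraph) (a b c d : ℕ) → Adj F a b
    → ¬ (c ≡ d) → ¬ (c ∈ V F) → ¬ (d ∈ V F)
    → (∀ x → (x ∈ V G) ⇔ ((x ∈ V F) ⊎ ((x ≡ c) ⊎ (x ≡ d))))
    → (∀ x y → Adj G x y ⇔ ((Adj F x y × ¬ SamePair x y a b) ⊎ SamePair x y c d))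
    → κ≤ F G
-- The vertex set of G is irrelevant: G-difference only inspects edges.
proposition1 F G a b c d adjF-ab c≢d c∉V d∉V _ adjG =
  lift-κ≤ F G adjG (relabelling (V F) a≢b c≢d c∉V d∉V)
  where
  a≢b : ¬ a ≡ b
  a≢b refl = irrefl F adjF-ab
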